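{- Let $f\colon A\to X$ be a normalized morphism in a gs-monoidal category. Then its domain $\mathrm{dom}(f)\colon A\to A$ is a functional morphism.
   Context: A gs-monoidal category is a symmetric monoidal category (tensor $\otimes$, unit $I$, unitors suppressed) whose objects carry commutative comonoids $\mathrm{copy}_A\colon A\to A\otimes A$, $\mathrm{del}_A\colon A\to I$ compatible with $\otimes$, with $\mathrm{del}_I=\mathrm{id}_I$. For $f\colon A\to X$: $\mathrm{dom}(f):=(\mathrm{id}_A\otimes(\mathrm{del}_X\circ f))\circ\mathrm{copy}_A$; $f$ is normalized if $f\circ\mathrm{dom}(f)=f$; a morphism $h\colon A\to Y$ is functional if $\mathrm{copy}_Y\circ h=(h\otimes h)\circ\mathrm{copy}_A$. -}

module Defs where

open import Level using (Level; suc; _⊔_)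
open import Relation.Binary using (Rel; IsEquivalence)

record SymmetricMonoidalCategory (o m e : Level) : Set (suc (o ⊔ m ⊔ e)) where
  infixr 9 _∘_
  infixr 10 _⊗₀_ _⊗₁_
  infix  4 _≈_
  field
    Obj   : Set o
    _⇒_   : Obj → Obj → Set m
    _≈_   : ∀ {A B} → Rel (A ⇒ B) e
    id    : ∀ {A} → A ⇒ A
    _∘_   : ∀ {A B C} → B ⇒ C → A ⇒ B → A ⇒ C
    ≈-equiv : ∀ {A B} → IsEquivalence (_≈_ {A} {B})
    ∘-resp-≈ : ∀ {A B C} {f g : B ⇒ C} {h k : A ⇒ B} → f ≈ g → h ≈ k → f ∘ h ≈ g ∘ k
    assoc : ∀ {A B C D} {f : A ⇒ B} {g : B ⇒ C} {h : C ⇒ D} → (h ∘ g) ∘ f ≈ h ∘ (g ∘ f)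
    identityˡ : ∀ {A B} {f : A ⇒ B} → id ∘ f ≈ f
    identityʳ : ∀ {A B} {f : A ⇒ B} → f ∘ id ≈ f

    _⊗₀_  : Obj → Obj → Obj
    unit  : Obj
    _⊗₁_  : ∀ {A B C D} → A ⇒ B → C ⇒ D → (A ⊗₀ C) ⇒ (B ⊗₀ D)
    ⊗-resp-≈ : ∀ {A B C D} {f g : A ⇒ B} {h k : C ⇒ D} → f ≈ g → h ≈ k → f ⊗₁ h ≈ g ⊗₁ k
    ⊗-identity : ∀ {A B} → id {A} ⊗₁ id {B} ≈ id
    ⊗-homomorphism : ∀ {A B C D E F} {f : A ⇒ B} {g : B ⇒ C} {h : D ⇒ E} {k : E ⇒ F} →
                     (g ∘ f) ⊗₁ (k ∘ h) ≈ (g ⊗₁ k) ∘ (f ⊗₁ h)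

    α⇒ : ∀ {A B C} → ((A ⊗₀ B) ⊗₀ C) ⇒ (A ⊗₀ (B ⊗₀ C))
    α⇐ : ∀ {A B C} → (A ⊗₀ (B ⊗₀ C)) ⇒ ((A ⊗₀ B) ⊗₀ C)
    λ⇒ : ∀ {A} → (unit ⊗₀ A) ⇒ A
    λ⇐ : ∀ {A} → A ⇒ (unit ⊗₀ A)
    ρ⇒ : ∀ {A} → (A ⊗₀ unit) ⇒ A
    ρ⇐ : ∀ {A} → A ⇒ (A ⊗₀ unit)
    σ  : ∀ {A B} → (A ⊗₀ B) ⇒ (B ⊗₀ A)

    α-iso₁ : ∀ {A B C} → α⇐ {A} {B} {C} ∘ α⇒ ≈ id
    α-iso₂ : ∀ {A B C} → α⇒ {A} {B} {C} ∘ α⇐ ≈ id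
    λ-iso₁ : ∀ {A} → λ⇐ {A} ∘ λ⇒ ≈ id
    λ-iso₂ : ∀ {A} → λ⇒ {A} ∘ λ⇐ ≈ id
    ρ-iso₁ : ∀ {A} → ρ⇐ {A} ∘ ρ⇒ ≈ id
    ρ-iso₂ : ∀ {A} → ρ⇒ {A} ∘ ρ⇐ ≈ id
    σ-inv  : ∀ {A B} → σ {B} {A} ∘ σ {A} {B} ≈ id

    α-natural : ∀ {A B C D E F} {f : A ⇒ D} {g : B ⇒ E} {h : C ⇒ F} →
                α⇒ ∘ ((f ⊗₁ g) ⊗₁ h) ≈ (f ⊗₁ (g ⊗₁ h)) ∘ α⇒
    λ-natural : ∀ {A B} {f : A ⇒ B} → λ⇒ ∘ (id ⊗₁ f) ≈ f ∘ λ⇒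
    ρ-natural : ∀ {A B} {f : A ⇒ B} → ρ⇒ ∘ (f ⊗₁ id) ≈ f ∘ ρ⇒
    σ-natural : ∀ {A B C D} {f : A ⇒ B} {g : C ⇒ D} → σ ∘ (f ⊗₁ g) ≈ (g ⊗₁ f) ∘ σ

    triangle : ∀ {A B} → (id {A} ⊗₁ λ⇒ {B}) ∘ α⇒ ≈ ρ⇒ ⊗₁ id
    pentagon : ∀ {A B C D} →
               (id {A} ⊗₁ α⇒ {B} {C} {D}) ∘ α⇒ ∘ (α⇒ ⊗₁ id) ≈ α⇒ ∘ α⇒
    hexagon : ∀ {A B C} →
              (id {B} ⊗₁ σ {A} {C}) ∘ α⇒ ∘ (σ ⊗₁ id) ≈ α⇒ ∘ σ ∘ α⇒

record GSMonoidalCategory (o m e : Level) : Set (suc (o ⊔ m ⊔ e)) where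
  field
    SMC : SymmetricMonoidalCategory o m e
  open SymmetricMonoidalCategory SMC public
  field
    copy : ∀ A → A ⇒ (A ⊗₀ A)
    del  : ∀ A → A ⇒ unit

    copy-coassoc : ∀ {A} → α⇒ ∘ (copy A ⊗₁ id) ∘ copy A ≈ (id ⊗₁ copy A) ∘ copy A
    copy-counitˡ : ∀ {A} → λ⇒ ∘ (del A ⊗₁ id) ∘ copy A ≈ id
    copy-counitʳ : ∀ {A} → ρ⇒ ∘ (id ⊗₁ del A) ∘ copy A ≈ id
    copy-comm    : ∀ {A} → σ ∘ copy A ≈ copy A

    del-unit  : del unit ≈ id
    del-⊗     : ∀ {A B} → del (A ⊗₀ B) ≈ λ⇒ ∘ (del A ⊗₁ del B)
    copy-⊗    : ∀ {A B} →
                copy (A ⊗₀ B) ≈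
                  α⇐ ∘ (id ⊗₁ (α⇒ ∘ (σ ⊗₁ id) ∘ α⇐)) ∘ α⇒ ∘ (copy A ⊗₁ copy B)

module _ {o m e} (C : GSMonoidalCategory o m e) where
  open GSMonoidalCategory C

  -- dom(f) := (id_A ⊗ (del_X ∘ f)) ∘ copy_A, with the right unitor made explicit
  dom : ∀ {A X} → A ⇒ X → A ⇒ A
  dom {A} {X} f = ρ⇒ ∘ (id ⊗₁ (del X ∘ f)) ∘ copy A

  Normalized : ∀ {A X} → A ⇒ X → Set e
  Normalized f = f ∘ dom f ≈ f

  Functional : ∀ {A Y} → A ⇒ Y → Set e
  Functional {A} {Y} h = copy Y ∘ h ≈ (h ⊗₁ h) ∘ copy A

module Submission where

open import Defs
open import Relation.Binary using (Setoid; IsEquivalence)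
import Relation.Binary.Reasoning.Setoid as SetoidReasoning

-- Writing d := del ∘ f, normalization of f says that multiplying the weight d by
-- itself (copy, apply d twice, merge the unit factors) gives d back: d is an
-- idempotent weight.  Restricting by an idempotent weight is idempotent, since
-- coassociativity lets the second copy of d merge with the first.  Restriction
-- commutes with postcomposition, and restricting one side of copy equals
-- restricting copy; so copy ∘ dom f, which is copy restricted once, equals copy
-- restricted twice, i.e. (dom f ⊗ dom f) ∘ copy.

module MonoidalProperties {o m e} (M : SymmetricMonoidalCategory o m e) where
  open SymmetricMonoidalCategory M

  hom-setoid : Obj → Obj → Setoid m e
  hom-setoid A B = record { isEquivalence = ≈-equiv {A} {B} }

  module HomReasoning {A B : Obj} = SetoidReasoning (hom-setoid A B)
  open HomReasoning public

  ≈-refl : ∀ {A B} {f : A ⇒ B} → f ≈ f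
  ≈-refl = IsEquivalence.refl ≈-equiv

  ≈-sym : ∀ {A B} {f g : A ⇒ B} → f ≈ g → g ≈ f
  ≈-sym = IsEquivalence.sym ≈-equiv

  ≈-trans : ∀ {A B} {f g h : A ⇒ B} → f ≈ g → g ≈ h → f ≈ h
  ≈-trans = IsEquivalence.trans ≈-equiv

  infixr 4 _⟩∘⟨_ refl⟩∘⟨_
  infixl 5 _⟩∘⟨refl

  _⟩∘⟨_ : ∀ {A B C} {f g : B ⇒ C} {h k : A ⇒ B} → f ≈ g → h ≈ k → f ∘ h ≈ g ∘ k
  _⟩∘⟨_ = ∘-resp-≈

  refl⟩∘⟨_ : ∀ {A B C} {f : B ⇒ C} {h k : A ⇒ B} → h ≈ k → f ∘ h ≈ f ∘ k
  refl⟩∘⟨ p = ≈-refl ⟩∘⟨ p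

  _⟩∘⟨refl : ∀ {A B C} {f g : B ⇒ C} {h : A ⇒ B} → f ≈ g → f ∘ h ≈ g ∘ h
  p ⟩∘⟨refl = p ⟩∘⟨ ≈-refl

  sym-assoc : ∀ {A B C D} {f : A ⇒ B} {g : B ⇒ C} {h : C ⇒ D} → h ∘ (g ∘ f) ≈ (h ∘ g) ∘ f
  sym-assoc = ≈-sym assoc

  pullˡ : ∀ {W A B C} {a : B ⇒ C} {b : A ⇒ B} {c : A ⇒ C} {f : W ⇒ A} →
          a ∘ b ≈ c → a ∘ (b ∘ f) ≈ c ∘ f
  pullˡ p = ≈-trans sym-assoc (p ⟩∘⟨refl)

  cancelˡ : ∀ {A B C} {i : B ⇒ C} {j : C ⇒ B} {f g : A ⇒ B} →
            j ∘ i ≈ id → i ∘ f ≈ i ∘ g → f ≈ g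
  cancelˡ {i = i} {j} {f} {g} j∘i≈id p = begin
    f            ≈⟨ identityˡ ⟨
    id ∘ f       ≈⟨ pullˡ j∘i≈id ⟨
    j ∘ i ∘ f    ≈⟨ refl⟩∘⟨ p ⟩
    j ∘ i ∘ g    ≈⟨ pullˡ j∘i≈id ⟩
    id ∘ g       ≈⟨ identityˡ ⟩
    g            ∎

  id⊗-∘ : ∀ {A B C D} {a : B ⇒ C} {b : A ⇒ B} → id {D} ⊗₁ (a ∘ b) ≈ (id ⊗₁ a) ∘ (id ⊗₁ b)
  id⊗-∘ = ≈-trans (⊗-resp-≈ (≈-sym identityˡ) ≈-refl) ⊗-homomorphism

  -⊗id-injective : ∀ {A B} {f g : A ⇒ B} → f ⊗₁ id {unit} ≈ g ⊗₁ id → f ≈ g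
  -⊗id-injective {f = f} {g} p = begin
    f                     ≈⟨ identityʳ ⟨
    f ∘ id                ≈⟨ refl⟩∘⟨ ρ-iso₂ ⟨
    f ∘ ρ⇒ ∘ ρ⇐           ≈⟨ pullˡ (≈-sym ρ-natural) ⟩
    (ρ⇒ ∘ (f ⊗₁ id)) ∘ ρ⇐ ≈⟨ (refl⟩∘⟨ p) ⟩∘⟨refl ⟩
    (ρ⇒ ∘ (g ⊗₁ id)) ∘ ρ⇐ ≈⟨ ρ-natural ⟩∘⟨refl ⟩
    (g ∘ ρ⇒) ∘ ρ⇐         ≈⟨ assoc ⟩
    g ∘ ρ⇒ ∘ ρ⇐           ≈⟨ refl⟩∘⟨ ρ-iso₂ ⟩
    g ∘ id                ≈⟨ identityʳ ⟩
    g                     ∎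

  -- Kelly's coherence law, derived from the triangle and pentagon axioms after
  -- tensoring with id on the right.
  id⊗ρ⇒∘α⇒≈ρ⇒ : ∀ {A B} → (id {A} ⊗₁ ρ⇒ {B}) ∘ α⇒ ≈ ρ⇒ {A ⊗₀ B}
  id⊗ρ⇒∘α⇒≈ρ⇒ {A} {B} = ≈-sym (-⊗id-injective (cancelˡ α-iso₁ (begin
    α⇒ ∘ (ρ⇒ ⊗₁ id)
      ≈⟨ refl⟩∘⟨ triangle ⟨
    α⇒ ∘ (id ⊗₁ λ⇒ {unit}) ∘ α⇒
      ≈⟨ refl⟩∘⟨ ⊗-resp-≈ ⊗-identity ≈-refl ⟩∘⟨refl ⟨
    α⇒ ∘ ((id {A} ⊗₁ id {B}) ⊗₁ λ⇒) ∘ α⇒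
      ≈⟨ pullˡ α-natural ⟩
    ((id ⊗₁ (id ⊗₁ λ⇒)) ∘ α⇒) ∘ α⇒
      ≈⟨ assoc ⟩
    (id ⊗₁ (id ⊗₁ λ⇒)) ∘ α⇒ ∘ α⇒
      ≈⟨ refl⟩∘⟨ pentagon ⟨
    (id ⊗₁ (id ⊗₁ λ⇒)) ∘ (id ⊗₁ α⇒) ∘ α⇒ ∘ (α⇒ ⊗₁ id)
      ≈⟨ pullˡ (≈-sym id⊗-∘) ⟩
    (id ⊗₁ ((id ⊗₁ λ⇒) ∘ α⇒)) ∘ α⇒ ∘ (α⇒ ⊗₁ id)
      ≈⟨ ⊗-resp-≈ ≈-refl triangle ⟩∘⟨refl ⟩
    (id ⊗₁ (ρ⇒ ⊗₁ id)) ∘ α⇒ ∘ (α⇒ ⊗₁ id)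
      ≈⟨ pullˡ (≈-sym α-natural) ⟩
    (α⇒ ∘ ((id ⊗₁ ρ⇒) ⊗₁ id)) ∘ (α⇒ ⊗₁ id)
      ≈⟨ assoc ⟩
    α⇒ ∘ ((id ⊗₁ ρ⇒) ⊗₁ id) ∘ (α⇒ ⊗₁ id)
      ≈⟨ refl⟩∘⟨ ⊗-homomorphism ⟨
    α⇒ ∘ (((id ⊗₁ ρ⇒) ∘ α⇒) ⊗₁ (id ∘ id))
      ≈⟨ refl⟩∘⟨ ⊗-resp-≈ ≈-refl identityˡ ⟩
    α⇒ ∘ (((id ⊗₁ ρ⇒) ∘ α⇒) ⊗₁ id) ∎)))

module Restriction {o m e} (C : GSMonoidalCategory o m e) where
  open GSMonoidalCategory C
  open MonoidalProperties SMC

  -- A morphism d : A ⇒ unit is a weight on A; restrict d g multiplies g by d,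
  -- so that dom f = restrict (del X ∘ f) id.
  restrict : ∀ {A B} → A ⇒ unit → A ⇒ B → A ⇒ B
  restrict {A} d g = ρ⇒ ∘ (g ⊗₁ d) ∘ copy A

  IdempotentWeight : ∀ {A} → A ⇒ unit → Set e
  IdempotentWeight d = restrict d d ≈ d

  module _ {A} (d : A ⇒ unit) where

    restrict-resp-≈ : ∀ {B} {g g′ : A ⇒ B} → g ≈ g′ → restrict d g ≈ restrict d g′
    restrict-resp-≈ p = refl⟩∘⟨ ⊗-resp-≈ p ≈-refl ⟩∘⟨refl

    ∘-restrict : ∀ {B D} (h : B ⇒ D) (g : A ⇒ B) → h ∘ restrict d g ≈ restrict d (h ∘ g)
    ∘-restrict h g = begin
      h ∘ ρ⇒ ∘ (g ⊗₁ d) ∘ copy A            ≈⟨ pullˡ (≈-sym ρ-natural) ⟩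
      (ρ⇒ ∘ (h ⊗₁ id)) ∘ (g ⊗₁ d) ∘ copy A  ≈⟨ assoc ⟩
      ρ⇒ ∘ (h ⊗₁ id) ∘ (g ⊗₁ d) ∘ copy A    ≈⟨ refl⟩∘⟨ pullˡ (≈-sym ⊗-homomorphism) ⟩
      ρ⇒ ∘ ((h ∘ g) ⊗₁ (id ∘ d)) ∘ copy A   ≈⟨ refl⟩∘⟨ ⊗-resp-≈ ≈-refl identityˡ ⟩∘⟨refl ⟩
      ρ⇒ ∘ ((h ∘ g) ⊗₁ d) ∘ copy A          ∎

    -- Coassociativity brings the two copies of d next to each other.
    restrict-⊗weight∘copy : IdempotentWeight d → ∀ {B} (y : A ⇒ B) →
                            restrict d ((y ⊗₁ d) ∘ copy A) ≈ (y ⊗₁ d) ∘ copy A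
    restrict-⊗weight∘copy idem y = begin
      ρ⇒ ∘ (((y ⊗₁ d) ∘ copy A) ⊗₁ d) ∘ copy A
        ≈⟨ refl⟩∘⟨ ≈-trans (⊗-resp-≈ ≈-refl (≈-sym identityʳ)) ⊗-homomorphism ⟩∘⟨refl ⟩
      ρ⇒ ∘ (((y ⊗₁ d) ⊗₁ d) ∘ (copy A ⊗₁ id)) ∘ copy A
        ≈⟨ ≈-sym id⊗ρ⇒∘α⇒≈ρ⇒ ⟩∘⟨ assoc ⟩
      ((id ⊗₁ ρ⇒) ∘ α⇒) ∘ ((y ⊗₁ d) ⊗₁ d) ∘ (copy A ⊗₁ id) ∘ copy A
        ≈⟨ assoc ⟩
      (id ⊗₁ ρ⇒) ∘ α⇒ ∘ ((y ⊗₁ d) ⊗₁ d) ∘ (copy A ⊗₁ id) ∘ copy A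
        ≈⟨ refl⟩∘⟨ ≈-trans (pullˡ α-natural) assoc ⟩
      (id ⊗₁ ρ⇒) ∘ (y ⊗₁ (d ⊗₁ d)) ∘ α⇒ ∘ (copy A ⊗₁ id) ∘ copy A
        ≈⟨ refl⟩∘⟨ refl⟩∘⟨ copy-coassoc ⟩
      (id ⊗₁ ρ⇒) ∘ (y ⊗₁ (d ⊗₁ d)) ∘ (id ⊗₁ copy A) ∘ copy A
        ≈⟨ refl⟩∘⟨ pullˡ (≈-sym ⊗-homomorphism) ⟩
      (id ⊗₁ ρ⇒) ∘ ((y ∘ id) ⊗₁ ((d ⊗₁ d) ∘ copy A)) ∘ copy A
        ≈⟨ pullˡ (≈-sym ⊗-homomorphism) ⟩
      ((id ∘ y ∘ id) ⊗₁ restrict d d) ∘ copy A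
        ≈⟨ ⊗-resp-≈ (≈-trans identityˡ identityʳ) idem ⟩∘⟨refl ⟩
      (y ⊗₁ d) ∘ copy A ∎

    restrict-idempotent : IdempotentWeight d → ∀ {B} (g : A ⇒ B) →
                          restrict d (restrict d g) ≈ restrict d g
    restrict-idempotent idem g = begin
      restrict d (ρ⇒ ∘ (g ⊗₁ d) ∘ copy A)  ≈⟨ ∘-restrict ρ⇒ ((g ⊗₁ d) ∘ copy A) ⟨
      ρ⇒ ∘ restrict d ((g ⊗₁ d) ∘ copy A)  ≈⟨ refl⟩∘⟨ restrict-⊗weight∘copy idem g ⟩
      ρ⇒ ∘ (g ⊗₁ d) ∘ copy A               ∎

    id⊗restrict∘copy : (id ⊗₁ restrict d id) ∘ copy A ≈ restrict d (copy A)
    id⊗restrict∘copy = begin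
      (id ⊗₁ (ρ⇒ ∘ (id ⊗₁ d) ∘ copy A)) ∘ copy A
        ≈⟨ ≈-trans id⊗-∘ (refl⟩∘⟨ id⊗-∘) ⟩∘⟨refl ⟩
      ((id ⊗₁ ρ⇒) ∘ (id ⊗₁ (id ⊗₁ d)) ∘ (id ⊗₁ copy A)) ∘ copy A
        ≈⟨ ≈-trans assoc (refl⟩∘⟨ assoc) ⟩
      (id ⊗₁ ρ⇒) ∘ (id ⊗₁ (id ⊗₁ d)) ∘ (id ⊗₁ copy A) ∘ copy A
        ≈⟨ refl⟩∘⟨ refl⟩∘⟨ copy-coassoc ⟨
      (id ⊗₁ ρ⇒) ∘ (id ⊗₁ (id ⊗₁ d)) ∘ α⇒ ∘ (copy A ⊗₁ id) ∘ copy A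
        ≈⟨ refl⟩∘⟨ ≈-trans (pullˡ (≈-sym α-natural)) assoc ⟩
      (id ⊗₁ ρ⇒) ∘ α⇒ ∘ ((id ⊗₁ id) ⊗₁ d) ∘ (copy A ⊗₁ id) ∘ copy A
        ≈⟨ pullˡ id⊗ρ⇒∘α⇒≈ρ⇒ ⟩
      ρ⇒ ∘ ((id ⊗₁ id) ⊗₁ d) ∘ (copy A ⊗₁ id) ∘ copy A
        ≈⟨ refl⟩∘⟨ pullˡ (≈-sym ⊗-homomorphism) ⟩
      ρ⇒ ∘ (((id ⊗₁ id) ∘ copy A) ⊗₁ (d ∘ id)) ∘ copy A
        ≈⟨ refl⟩∘⟨ ⊗-resp-≈ (≈-trans (⊗-identity ⟩∘⟨refl) identityˡ) identityʳ ⟩∘⟨refl ⟩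
      ρ⇒ ∘ (copy A ⊗₁ d) ∘ copy A ∎

    restrict⊗id∘copy : (restrict d id ⊗₁ id) ∘ copy A ≈ restrict d (copy A)
    restrict⊗id∘copy = begin
      (restrict d id ⊗₁ id) ∘ copy A        ≈⟨ refl⟩∘⟨ copy-comm ⟨
      (restrict d id ⊗₁ id) ∘ σ ∘ copy A    ≈⟨ pullˡ (≈-sym σ-natural) ⟩
      (σ ∘ (id ⊗₁ restrict d id)) ∘ copy A  ≈⟨ assoc ⟩
      σ ∘ (id ⊗₁ restrict d id) ∘ copy A    ≈⟨ refl⟩∘⟨ id⊗restrict∘copy ⟩
      σ ∘ restrict d (copy A)               ≈⟨ ∘-restrict σ (copy A) ⟩
      restrict d (σ ∘ copy A)               ≈⟨ restrict-resp-≈ copy-comm ⟩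
      restrict d (copy A)                   ∎

    restrict-id-functional : IdempotentWeight d → Functional C (restrict d id)
    restrict-id-functional idem = begin
      copy A ∘ δ                                 ≈⟨ ∘-restrict (copy A) id ⟩
      restrict d (copy A ∘ id)                   ≈⟨ restrict-resp-≈ identityʳ ⟩
      restrict d (copy A)                        ≈⟨ restrict-idempotent idem (copy A) ⟨
      restrict d (restrict d (copy A))           ≈⟨ restrict-resp-≈ restrict⊗id∘copy ⟨
      restrict d ((δ ⊗₁ id) ∘ copy A)            ≈⟨ ∘-restrict (δ ⊗₁ id) (copy A) ⟨
      (δ ⊗₁ id) ∘ restrict d (copy A)            ≈⟨ refl⟩∘⟨ id⊗restrict∘copy ⟨
      (δ ⊗₁ id) ∘ (id ⊗₁ δ) ∘ copy A             ≈⟨ pullˡ (≈-sym ⊗-homomorphism) ⟩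
      ((δ ∘ id) ⊗₁ (id ∘ δ)) ∘ copy A            ≈⟨ ⊗-resp-≈ identityʳ identityˡ ⟩∘⟨refl ⟩
      (δ ⊗₁ δ) ∘ copy A                          ∎
      where
      δ : A ⇒ A
      δ = restrict d id

  Normalized⇒IdempotentWeight : ∀ {A X} (f : A ⇒ X) → Normalized C f →
                                IdempotentWeight (del X ∘ f)
  Normalized⇒IdempotentWeight {A} {X} f normalized = begin
    restrict d d         ≈⟨ restrict-resp-≈ d identityʳ ⟨
    restrict d (d ∘ id)  ≈⟨ ∘-restrict d d id ⟨
    d ∘ dom C f          ≈⟨ assoc ⟩
    del X ∘ f ∘ dom C f  ≈⟨ refl⟩∘⟨ normalized ⟩
    d                    ∎
    where
    d : A ⇒ unit
    d = del X ∘ f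

mainTheorem19 : ∀ {o m e} (C : GSMonoidalCategory o m e) →
    let open GSMonoidalCategory C in
    ∀ {A X} (f : A ⇒ X) → Normalized C f → Functional C (dom C f)
mainTheorem19 C f normalized =
  restrict-id-functional _ (Normalized⇒IdempotentWeight f normalized)
  where open Restriction C
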